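{- Let $\mathsf{M}$ be a matroid of rank $k$ with two distinct stressed hyperplanes $H_1$ and $H_2$. If $\widetilde{\mathsf{M}}$ is the relaxation of $\mathsf{M}$ at $H_1$, then $H_2$ is a stressed hyperplane of $\widetilde{\mathsf{M}}$.
   Context: A hyperplane of a matroid of rank $k$ is a flat of rank $k-1$; it is stressed if all its subsets of cardinality $k$ are circuits. If $\mathsf{M}=(E,\mathscr{B})$ has a stressed hyperplane $H$, the relaxation of $\mathsf{M}$ at $H$ is the matroid $(E,\mathscr{B}\sqcup\{S\subseteq H:|S|=k\})$. -}

module Defs where

open import Data.Nat using (ℕ; _≤_; _∸_)
open import Data.Fin using (Fin)
open import Data.Fin.Subset using (Subset; _∈_; _∉_; _⊆_; _⊂_; _∪_; _-_; ⁅_⁆; ∣_∣; ⊤)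
open import Data.Product using (Σ; ∃; _×_; _,_)
open import Data.Sum using (_⊎_)
open import Relation.Nullary using (¬_)
open import Relation.Binary.PropositionalEquality using (_≡_)

BaseFamily : ℕ → Set₁
BaseFamily n = Subset n → Set

module _ {n : ℕ} (𝓑 : BaseFamily n) where

  record IsMatroid : Set where
    field
      base-nonempty : Σ (Subset n) 𝓑
      base-exchange : ∀ B₁ B₂ → 𝓑 B₁ → 𝓑 B₂ → ∀ x → x ∈ B₁ → x ∉ B₂ →
                      Σ (Fin n) λ y → y ∈ B₂ × y ∉ B₁ × 𝓑 ((B₁ - x) ∪ ⁅ y ⁆)

  Independent : Subset n → Set
  Independent I = Σ (Subset n) λ B → 𝓑 B × I ⊆ B

  HasRank : Subset n → ℕ → Set
  HasRank X r = (Σ (Subset n) λ I → I ⊆ X × Independent I × ∣ I ∣ ≡ r)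
              × (∀ I → I ⊆ X → Independent I → ∣ I ∣ ≤ r)

  MatroidRank : ℕ → Set
  MatroidRank k = HasRank ⊤ k

  Circuit : Subset n → Set
  Circuit C = ¬ Independent C × (∀ D → D ⊂ C → Independent D)

  Flat : Subset n → Set
  Flat F = ∀ e → e ∉ F → ∀ r → HasRank F r → ¬ HasRank (F ∪ ⁅ e ⁆) r

  Hyperplane : ℕ → Subset n → Set
  Hyperplane k H = Flat H × HasRank H (k ∸ 1)

  StressedHyperplane : ℕ → Subset n → Set
  StressedHyperplane k H =
    Hyperplane k H × (∀ S → S ⊆ H → ∣ S ∣ ≡ k → Circuit S)

  Relaxation : ℕ → Subset n → BaseFamily n
  Relaxation k H S = 𝓑 S ⊎ (S ⊆ H × ∣ S ∣ ≡ k)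

-- Since every k-subset of H₁ is a circuit, the only sets that become independent in the
-- relaxation are those k-subsets themselves. So H₂ keeps its rank and its k-circuits as soon
-- as no k-subset of H₁ lies in H₂, and it stays flat regardless: it has rank k - 1, which
-- sets of size k cannot witness. A common k-subset S would be a k-circuit, so removing a
-- point from S leaves an independent (k-1)-set J inside H₁ ∩ H₂. For e ∈ H₁ ∖ H₂, flatness
-- of H₂ makes H₂ ∪ {e} contain a basis B, and two basis exchanges between B and a basis
-- containing J produce an independent k-subset of H₁ or of H₂, which is impossible. Hence
-- H₁ ⊆ H₂, and symmetrically H₁ = H₂.

module Submission where

open import Defs
open import Data.Nat using (ℕ; zero; suc; _≤_; _<_; s≤s; z≤n)
open import Data.Nat.Properties using (≤-refl; n≤1+n; ≮⇒≥; ≤-trans; ≤-antisym; <-≤-trans; <⇒≱; <-irrefl)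
open import Data.Fin using (Fin; zero; suc; _≟_)
open import Data.Fin.Properties using (any?)
open import Data.Fin.Subset using (Subset; _∈_; _∉_; _⊆_; _⊂_; _∪_; _─_; _-_; ⁅_⁆; ∣_∣; ⊤; inside; outside; Nonempty) renaming (⊥ to ∅)
open import Data.Fin.Subset.Properties using (_∈?_; ⊆⊤; ⊥⊆; ⊆-refl; ∣⊥∣≡0; x∈⁅x⁆; x∈⁅y⁆⇒x≡y; p⊆p∪q; q⊆p∪q; x∈p∪q⁻; ∪-identityʳ; p─q⊆p; x∈p∧x≢y⇒x∈p-y; x∈p⇒p-x⊂p; p⊆q⇒∣p∣≤∣q∣; p⊂q⇒∣p∣<∣q∣; ⊆-antisym)
open import Data.Vec using (_∷_; here; there)
open import Data.Product using (∃; _×_; _,_; proj₁; proj₂)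
open import Data.Sum using (_⊎_; inj₁; inj₂; [_,_])
open import Data.Empty using (⊥; ⊥-elim)
open import Relation.Nullary using (¬_; yes; no)
open import Relation.Nullary.Decidable using (_×-dec_; ¬?)
open import Relation.Binary.PropositionalEquality using (_≡_; _≢_; refl; sym; trans; subst)

x∈p─q⇒x∉q : ∀ {n} {x : Fin n} (p q : Subset n) → x ∈ p ─ q → x ∉ q
x∈p─q⇒x∉q (_ ∷ p) (outside ∷ q) (there x∈p─q) (there x∈q) = x∈p─q⇒x∉q p q x∈p─q x∈q
x∈p─q⇒x∉q (_ ∷ p) (inside  ∷ q) (there x∈p─q) (there x∈q) = x∈p─q⇒x∉q p q x∈p─q x∈q

x∈p-y⇒x≢y : ∀ {n} {x y : Fin n} {p : Subset n} → x ∈ p - y → x ≢ y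
x∈p-y⇒x≢y {x = x} {p = p} x∈p-y refl = x∈p─q⇒x∉q p ⁅ x ⁆ x∈p-y (x∈⁅x⁆ x)

∣p∪⁅x⁆∣≤1+∣p∣ : ∀ {n} (p : Subset n) (x : Fin n) → ∣ p ∪ ⁅ x ⁆ ∣ ≤ suc ∣ p ∣
∣p∪⁅x⁆∣≤1+∣p∣ (inside  ∷ p) zero    rewrite ∪-identityʳ p = n≤1+n _
∣p∪⁅x⁆∣≤1+∣p∣ (outside ∷ p) zero    rewrite ∪-identityʳ p = ≤-refl
∣p∪⁅x⁆∣≤1+∣p∣ (inside  ∷ p) (suc x) = s≤s (∣p∪⁅x⁆∣≤1+∣p∣ p x)
∣p∪⁅x⁆∣≤1+∣p∣ (outside ∷ p) (suc x) = ∣p∪⁅x⁆∣≤1+∣p∣ p x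

∣p∣≤1+∣p-x∣ : ∀ {n} {x : Fin n} {p : Subset n} → x ∈ p → ∣ p ∣ ≤ suc ∣ p - x ∣
∣p∣≤1+∣p-x∣ {x = x} {p} x∈p = ≤-trans (p⊆q⇒∣p∣≤∣q∣ p⊆p-x∪⁅x⁆) (∣p∪⁅x⁆∣≤1+∣p∣ (p - x) x)
  where
  p⊆p-x∪⁅x⁆ : p ⊆ (p - x) ∪ ⁅ x ⁆
  p⊆p-x∪⁅x⁆ {y} y∈p with y ≟ x
  ... | yes refl = q⊆p∪q (p - x) ⁅ x ⁆ (x∈⁅x⁆ x)
  ... | no y≢x   = p⊆p∪q ⁅ x ⁆ (x∈p∧x≢y⇒x∈p-y y∈p y≢x)

x∉p⇒∣p∣<∣p∪⁅x⁆∣ : ∀ {n} {x : Fin n} {p : Subset n} → x ∉ p → ∣ p ∣ < ∣ p ∪ ⁅ x ⁆ ∣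
x∉p⇒∣p∣<∣p∪⁅x⁆∣ {x = x} {p} x∉p = p⊂q⇒∣p∣<∣q∣ (p⊆p∪q ⁅ x ⁆ , x , q⊆p∪q p ⁅ x ⁆ (x∈⁅x⁆ x) , x∉p)

p⊆r∧x∈r⇒p∪⁅x⁆⊆r : ∀ {n} {x : Fin n} {p r : Subset n} → p ⊆ r → x ∈ r → p ∪ ⁅ x ⁆ ⊆ r
p⊆r∧x∈r⇒p∪⁅x⁆⊆r {x = x} {p} p⊆r x∈r y∈p∪⁅x⁆ with x∈p∪q⁻ p ⁅ x ⁆ y∈p∪⁅x⁆
... | inj₁ y∈p   = p⊆r y∈p
... | inj₂ y∈⁅x⁆ rewrite x∈⁅y⁆⇒x≡y x y∈⁅x⁆ = x∈r

p⊆q⇒p≡q⊎p⊂q : ∀ {n} {p q : Subset n} → p ⊆ q → p ≡ q ⊎ p ⊂ q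
p⊆q⇒p≡q⊎p⊂q {p = p} {q} p⊆q with any? (λ x → (x ∈? q) ×-dec ¬? (x ∈? p))
... | yes (x , x∈q , x∉p) = inj₂ (p⊆q , x , x∈q , x∉p)
... | no ∄x = inj₁ (⊆-antisym p⊆q q⊆p)
  where
  q⊆p : q ⊆ p
  q⊆p {x} x∈q with x ∈? p
  ... | yes x∈p = x∈p
  ... | no x∉p  = ⊥-elim (∄x (x , x∈q , x∉p))

0<∣p∣⇒Nonempty : ∀ {n} (p : Subset n) → 0 < ∣ p ∣ → Nonempty p
0<∣p∣⇒Nonempty (inside  ∷ p) _ = zero , here
0<∣p∣⇒Nonempty (outside ∷ p) 0<∣p∣ with 0<∣p∣⇒Nonempty p 0<∣p∣
... | x , x∈p = suc x , there x∈p

module _ {n : ℕ} {𝓑 : BaseFamily n} where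

  hasRank-unique : ∀ {X r s} → HasRank 𝓑 X r → HasRank 𝓑 X s → r ≡ s
  hasRank-unique ((I , I⊆X , indI , refl) , ≤r) ((J , J⊆X , indJ , refl) , ≤s) =
    ≤-antisym (≤s I I⊆X indI) (≤r J J⊆X indJ)

  hasRank⇒¬rank<∣independent∣ : ∀ {X r I} → HasRank 𝓑 X r → I ⊆ X → Independent 𝓑 I → ¬ r < ∣ I ∣
  hasRank⇒¬rank<∣independent∣ (_ , ≤r) I⊆X indI r<∣I∣ = <⇒≱ r<∣I∣ (≤r _ I⊆X indI)

  module _ (M : IsMatroid 𝓑) where
    open IsMatroid M

    ∅-independent : Independent 𝓑 ∅
    ∅-independent = let B , bB = base-nonempty in B , bB , ⊥⊆

    ¬stressedHyperplane-rank0 : ∀ {H} → ¬ StressedHyperplane 𝓑 0 H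
    ¬stressedHyperplane-rank0 (_ , circuits) =
      proj₁ (circuits ∅ ⊥⊆ (∣⊥∣≡0 n)) ∅-independent

    exchange-into-or-augment : ∀ {B B₀ J e} → 𝓑 B → 𝓑 B₀ → J ⊆ B₀ → e ∈ B → e ∉ B₀ →
      (∃ λ y → y ∈ J × y ∉ B × 𝓑 ((B - e) ∪ ⁅ y ⁆)) ⊎
      (∃ λ z → z ∈ B × z ∉ J × Independent 𝓑 (J ∪ ⁅ z ⁆))
    exchange-into-or-augment {B} {B₀} {J} {e} bB bB₀ J⊆B₀ e∈B e∉B₀
      with base-exchange B B₀ bB bB₀ e e∈B e∉B₀
    ... | y , y∈B₀ , y∉B , bB-e+y with y ∈? J
    ...   | yes y∈J = inj₁ (y , y∈J , y∉B , bB-e+y)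
    ...   | no y∉J with base-exchange B₀ B bB₀ bB y y∈B₀ y∉B
    ...     | z , z∈B , z∉B₀ , bB₀-y+z =
      inj₂ (z , z∈B , (λ z∈J → z∉B₀ (J⊆B₀ z∈J)) , _ , bB₀-y+z , p⊆r∧x∈r⇒p∪⁅x⁆⊆r J⊆B₀-y+z z∈B₀-y+z)
      where
      z∈B₀-y+z : z ∈ (B₀ - y) ∪ ⁅ z ⁆
      z∈B₀-y+z = q⊆p∪q (B₀ - y) ⁅ z ⁆ (x∈⁅x⁆ z)
      J⊆B₀-y+z : J ⊆ (B₀ - y) ∪ ⁅ z ⁆
      J⊆B₀-y+z {x} x∈J = p⊆p∪q ⁅ z ⁆ (x∈p∧x≢y⇒x∈p-y (J⊆B₀ x∈J) λ { refl → y∉J x∈J })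

    module _ {k} (rk : MatroidRank 𝓑 k) where

      independent∧k≤∣I∣⇒base : ∀ {I} → Independent 𝓑 I → k ≤ ∣ I ∣ → 𝓑 I
      independent∧k≤∣I∣⇒base (B , bB , I⊆B) k≤∣I∣ with p⊆q⇒p≡q⊎p⊂q I⊆B
      ... | inj₁ refl = bB
      ... | inj₂ I⊂B  = ⊥-elim
        (<⇒≱ (p⊂q⇒∣p∣<∣q∣ I⊂B) (≤-trans (proj₂ rk B ⊆⊤ (B , bB , ⊆-refl)) k≤∣I∣))

    module _ {r H H′ S} (rankH : HasRank 𝓑 H r) (rankH′ : HasRank 𝓑 H′ r)
             (circuitS : Circuit 𝓑 S) (∣S∣≡1+r : ∣ S ∣ ≡ suc r) (S⊆H : S ⊆ H) (S⊆H′ : S ⊆ H′) where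

      ¬independent[S-s]∪⁅x⁆ : ∀ {s x} → s ∈ S → x ∉ S - s → x ∈ H ⊎ x ∈ H′ →
                               ¬ Independent 𝓑 ((S - s) ∪ ⁅ x ⁆)
      ¬independent[S-s]∪⁅x⁆ {s} {x} s∈S x∉S-s x∈H∪H′ ind = [ too-big rankH S⊆H , too-big rankH′ S⊆H′ ] x∈H∪H′
        where
        r<∣[S-s]∪⁅x⁆∣ : r < ∣ (S - s) ∪ ⁅ x ⁆ ∣
        r<∣[S-s]∪⁅x⁆∣ = ≤-trans (subst (_≤ suc ∣ S - s ∣) ∣S∣≡1+r (∣p∣≤1+∣p-x∣ s∈S)) (x∉p⇒∣p∣<∣p∪⁅x⁆∣ x∉S-s)
        too-big : ∀ {X} → HasRank 𝓑 X r → S ⊆ X → x ∈ X → ⊥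
        too-big rankX S⊆X x∈X = hasRank⇒¬rank<∣independent∣ rankX
          (p⊆r∧x∈r⇒p∪⁅x⁆⊆r (λ y∈S-s → S⊆X (p─q⊆p S ⁅ s ⁆ y∈S-s)) x∈X) ind r<∣[S-s]∪⁅x⁆∣

      private
        module _ {e B} (e∈H : e ∈ H) (e∉H′ : e ∉ H′) (bB : 𝓑 B) (r<∣B∣ : r < ∣ B ∣)
                 (B⊆H′∪⁅e⁆ : B ⊆ H′ ∪ ⁅ e ⁆) where

          ∈H′⊎≡e : ∀ {x} → x ∈ B → x ∈ H′ ⊎ x ≡ e
          ∈H′⊎≡e x∈B with x∈p∪q⁻ H′ ⁅ e ⁆ (B⊆H′∪⁅e⁆ x∈B)
          ... | inj₁ x∈H′  = inj₁ x∈H′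
          ... | inj₂ x∈⁅e⁆ = inj₂ (x∈⁅y⁆⇒x≡y e x∈⁅e⁆)

          B-e⊆H′ : B - e ⊆ H′
          B-e⊆H′ {x} x∈B-e with ∈H′⊎≡e (p─q⊆p B ⁅ e ⁆ x∈B-e)
          ... | inj₁ x∈H′ = x∈H′
          ... | inj₂ x≡e  = ⊥-elim (x∈p-y⇒x≢y x∈B-e x≡e)

          e∈B : e ∈ B
          e∈B with e ∈? B
          ... | yes e∈B = e∈B
          ... | no e∉B  = ⊥-elim (hasRank⇒¬rank<∣independent∣ rankH′ B⊆H′ (B , bB , ⊆-refl) r<∣B∣)
            where
            B⊆H′ : B ⊆ H′
            B⊆H′ {x} x∈B with ∈H′⊎≡e x∈B
            ... | inj₁ x∈H′ = x∈H′
            ... | inj₂ refl = ⊥-elim (e∉B x∈B)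

          ¬base⊇S-s : ∀ {s B₀} → s ∈ S → 𝓑 B₀ → S - s ⊆ B₀ → ⊥
          ¬base⊇S-s {s} {B₀} s∈S bB₀ J⊆B₀ with e ∈? B₀
          ... | yes e∈B₀ = ¬independent[S-s]∪⁅x⁆ s∈S (λ e∈J → e∉H′ (S⊆H′ (p─q⊆p S ⁅ s ⁆ e∈J))) (inj₁ e∈H)
                             (B₀ , bB₀ , p⊆r∧x∈r⇒p∪⁅x⁆⊆r J⊆B₀ e∈B₀)
          ... | no e∉B₀ with exchange-into-or-augment bB bB₀ J⊆B₀ e∈B e∉B₀
          ...   | inj₂ (z , z∈B , z∉J , indJ∪⁅z⁆) =
                  ¬independent[S-s]∪⁅x⁆ s∈S z∉J ([ inj₂ , (λ { refl → inj₁ e∈H }) ] (∈H′⊎≡e z∈B)) indJ∪⁅z⁆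
          ...   | inj₁ (y , y∈J , y∉B , bB-e+y) =
                  hasRank⇒¬rank<∣independent∣ rankH′ (p⊆r∧x∈r⇒p∪⁅x⁆⊆r B-e⊆H′ (S⊆H′ (p─q⊆p S ⁅ s ⁆ y∈J)))
                    (_ , bB-e+y , ⊆-refl) r<∣[B-e]∪⁅y⁆∣
            where
            r<∣[B-e]∪⁅y⁆∣ : r < ∣ (B - e) ∪ ⁅ y ⁆ ∣
            r<∣[B-e]∪⁅y⁆∣ = <-≤-trans r<∣B∣
              (≤-trans (∣p∣≤1+∣p-x∣ e∈B) (x∉p⇒∣p∣<∣p∪⁅x⁆∣ (λ y∈B-e → y∉B (p─q⊆p B ⁅ e ⁆ y∈B-e))))

      ¬base⊆H′∪⁅e⁆ : ∀ {e B} → e ∈ H → e ∉ H′ → 𝓑 B → r < ∣ B ∣ → ¬ B ⊆ H′ ∪ ⁅ e ⁆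
      ¬base⊆H′∪⁅e⁆ e∈H e∉H′ bB r<∣B∣ B⊆H′∪⁅e⁆ =
        let s , s∈S = 0<∣p∣⇒Nonempty S (subst (0 <_) (sym ∣S∣≡1+r) (s≤s z≤n))
            B₀ , bB₀ , S-s⊆B₀ = proj₂ circuitS (S - s) (x∈p⇒p-x⊂p s∈S)
        in ¬base⊇S-s e∈H e∉H′ bB r<∣B∣ B⊆H′∪⁅e⁆ s∈S bB₀ S-s⊆B₀

    module _ {r} (rk : MatroidRank 𝓑 (suc r)) where

      shared-circuit⇒⊆flat : ∀ {H H′ S} → HasRank 𝓑 H r → HasRank 𝓑 H′ r → Flat 𝓑 H′ →
                             Circuit 𝓑 S → ∣ S ∣ ≡ suc r → S ⊆ H → S ⊆ H′ → H ⊆ H′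
      shared-circuit⇒⊆flat {H} {H′} rankH rankH′ flatH′ circuitS ∣S∣≡1+r S⊆H S⊆H′ {e} e∈H with e ∈? H′
      ... | yes e∈H′ = e∈H′
      ... | no e∉H′  = ⊥-elim (flatH′ e e∉H′ r rankH′ (lower , upper))
        where
        lower : ∃ λ I → I ⊆ H′ ∪ ⁅ e ⁆ × Independent 𝓑 I × ∣ I ∣ ≡ r
        lower = let I , I⊆H′ , indI , ∣I∣≡r = proj₁ rankH′
                in I , (λ x∈I → p⊆p∪q ⁅ e ⁆ (I⊆H′ x∈I)) , indI , ∣I∣≡r
        upper : ∀ I → I ⊆ H′ ∪ ⁅ e ⁆ → Independent 𝓑 I → ∣ I ∣ ≤ r
        upper I I⊆H′∪⁅e⁆ indI = ≮⇒≥ λ r<∣I∣ →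
          ¬base⊆H′∪⁅e⁆ rankH rankH′ circuitS ∣S∣≡1+r S⊆H S⊆H′ e∈H e∉H′
            (independent∧k≤∣I∣⇒base rk indI r<∣I∣) r<∣I∣ I⊆H′∪⁅e⁆

      common-k-subset⇒stressedHyperplane-≡ : ∀ {H₁ H₂ S} →
        StressedHyperplane 𝓑 (suc r) H₁ → StressedHyperplane 𝓑 (suc r) H₂ →
        S ⊆ H₁ → S ⊆ H₂ → ∣ S ∣ ≡ suc r → H₁ ≡ H₂
      common-k-subset⇒stressedHyperplane-≡ {S = S} ((flat₁ , rank₁) , circuits₁) ((flat₂ , rank₂) , _)
                                           S⊆H₁ S⊆H₂ ∣S∣≡1+r =
        ⊆-antisym (shared-circuit⇒⊆flat rank₁ rank₂ flat₂ circuitS ∣S∣≡1+r S⊆H₁ S⊆H₂)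
                  (shared-circuit⇒⊆flat rank₂ rank₁ flat₁ circuitS ∣S∣≡1+r S⊆H₂ S⊆H₁)
        where
        circuitS : Circuit 𝓑 S
        circuitS = circuits₁ S S⊆H₁ ∣S∣≡1+r

module RelaxationProperties {n k} {𝓑 : BaseFamily n} {H : Subset n}
         (H-circuits : ∀ S → S ⊆ H → ∣ S ∣ ≡ k → Circuit 𝓑 S) where

  𝓑′ : BaseFamily n
  𝓑′ = Relaxation 𝓑 k H

  independent-relax⁺ : ∀ {I} → Independent 𝓑 I → Independent 𝓑′ I
  independent-relax⁺ (B , bB , I⊆B) = B , inj₁ bB , I⊆B

  independent-relax⁻ : ∀ {I} → Independent 𝓑′ I → Independent 𝓑 I ⊎ (I ⊆ H × ∣ I ∣ ≡ k)
  independent-relax⁻ (B , inj₁ bB , I⊆B) = inj₁ (B , bB , I⊆B)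
  independent-relax⁻ (B , inj₂ (B⊆H , ∣B∣≡k) , I⊆B) with p⊆q⇒p≡q⊎p⊂q I⊆B
  ... | inj₁ refl = inj₂ (B⊆H , ∣B∣≡k)
  ... | inj₂ I⊂B  = inj₁ (proj₂ (H-circuits B B⊆H ∣B∣≡k) _ I⊂B)

  hasRank-relax⁻ : ∀ {X r} → r < k → HasRank 𝓑′ X r → HasRank 𝓑 X r
  hasRank-relax⁻ r<k ((I , I⊆X , indI , ∣I∣≡r) , ≤r) with independent-relax⁻ indI
  ... | inj₁ indI       = (I , I⊆X , indI , ∣I∣≡r) , λ J J⊆X indJ → ≤r J J⊆X (independent-relax⁺ indJ)
  ... | inj₂ (_ , ∣I∣≡k) = ⊥-elim (<-irrefl (trans (sym ∣I∣≡r) ∣I∣≡k) r<k)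

  flat-relax : ∀ {X r} → HasRank 𝓑′ X r → r < k → Flat 𝓑 X → Flat 𝓑′ X
  flat-relax rankX r<k flatX e e∉X s rankX′ rankX∪⁅e⁆′ =
    flatX e e∉X s (hasRank-relax⁻ s<k rankX′) (hasRank-relax⁻ s<k rankX∪⁅e⁆′)
    where
    s<k : s < k
    s<k = subst (_< k) (sym (hasRank-unique rankX′ rankX)) r<k

  module _ {X} (no-common-k-subset : ∀ S → S ⊆ X → S ⊆ H → ∣ S ∣ ≢ k) where

    independent-relax⁻-within : ∀ {I} → I ⊆ X → Independent 𝓑′ I → Independent 𝓑 I
    independent-relax⁻-within {I} I⊆X indI with independent-relax⁻ indI
    ... | inj₁ indI′        = indI′
    ... | inj₂ (I⊆H , ∣I∣≡k) = ⊥-elim (no-common-k-subset I I⊆X I⊆H ∣I∣≡k)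

    hasRank-relax⁺ : ∀ {r} → HasRank 𝓑 X r → HasRank 𝓑′ X r
    hasRank-relax⁺ ((I , I⊆X , indI , ∣I∣≡r) , ≤r) =
      (I , I⊆X , independent-relax⁺ indI , ∣I∣≡r) , λ J J⊆X indJ → ≤r J J⊆X (independent-relax⁻-within J⊆X indJ)

    circuit-relax⁺ : ∀ {C} → C ⊆ X → Circuit 𝓑 C → Circuit 𝓑′ C
    circuit-relax⁺ C⊆X (dependent , minimal) =
      (λ indC → dependent (independent-relax⁻-within C⊆X indC)) ,
      λ D D⊂C → independent-relax⁺ (minimal D D⊂C)

proposition3p9 : (n k : ℕ) (𝓑 : BaseFamily n) → IsMatroid 𝓑 → MatroidRank 𝓑 k →
    (H₁ H₂ : Subset n) → H₁ ≢ H₂ →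
    StressedHyperplane 𝓑 k H₁ → StressedHyperplane 𝓑 k H₂ →
    StressedHyperplane (Relaxation 𝓑 k H₁) k H₂
proposition3p9 n zero    𝓑 M _  _  _  _       stressed₁ _ = ⊥-elim (¬stressedHyperplane-rank0 M stressed₁)
proposition3p9 n (suc r) 𝓑 M rk H₁ H₂ H₁≢H₂ stressed₁ stressed₂@((flat₂ , rank₂) , circuits₂) =
  (flat-relax rank₂′ ≤-refl flat₂ , rank₂′) ,
  λ S S⊆H₂ ∣S∣≡k → circuit-relax⁺ no-common-k-subset S⊆H₂ (circuits₂ S S⊆H₂ ∣S∣≡k)
  where
  open RelaxationProperties (proj₂ stressed₁)
  no-common-k-subset : ∀ S → S ⊆ H₂ → S ⊆ H₁ → ∣ S ∣ ≢ suc r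
  no-common-k-subset S S⊆H₂ S⊆H₁ ∣S∣≡k =
    H₁≢H₂ (common-k-subset⇒stressedHyperplane-≡ M rk stressed₁ stressed₂ S⊆H₁ S⊆H₂ ∣S∣≡k)
  rank₂′ : HasRank 𝓑′ H₂ r
  rank₂′ = hasRank-relax⁺ no-common-k-subset rank₂
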